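{- Let $\mathbf d=(d_1,\dots,d_n)$ and $\hat{\mathbf d}=(\hat d_1,\dots,\hat d_n)$ be sequences of nonnegative integers with $\sum_{i=1}^n d_i=\sum_{i=1}^n\hat d_i$, and let $P$ be a distribution on the nonnegative integers with $\Pr[P=d_i]>0$ for every $i\in[n]$. Then for every bipartite multigraph $G$ on users $V=\{v_1,\dots,v_n\}$ and ads $\hat V=\{\hat v_1,\dots,\hat v_n\}$, $$\Pr_{X\sim\mathcal{L}(n,n,P)}\left[X=G\ \middle|\ \deg(v_i)=d_i\text{ and }\deg(\hat v_i)=\hat d_i\text{ for all }i\in[n]\right]=\Pr_{X\sim\mathrm{CM}(\mathbf d,\hat{\mathbf d})}[X=G].$$
   Context: Irregular cuckoo hashing model $\mathcal{L}(n,m,P)$: users $V=\{v_1,\dots,v_n\}$, ads $\hat V=\{\hat v_1,\dots,\hat v_m\}$; each user independently samples $d_i\sim P$ and then $d_i$ ads independently and uniformly at random from $\hat V$ with replacement; the resulting bipartite multigraph has one edge from $v_i$ to each sampled ad (with multiplicity). Configuration model $\mathrm{CM}(\mathbf d,\hat{\mathbf d})$ for nonnegative integer sequences $\mathbf d=(d_1,\dots,d_n)$, $\hat{\mathbf d}=(\hat d_1,\dots,\hat d_m)$ with equal sums: give vertex $v_i$ exactly $d_i$ configuration points and vertex $\hat v_j$ exactly $\hat d_j$ configuration points, choose a uniformly random perfect bipartite matching between the points of the $v$'s and the points of the $\hat v$'s, and let the multigraph have one edge $\{v_i,\hat v_j\}$ for each matched pair of points of $v_i$ and $\hat v_j$.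 Two multigraphs are equal if they have the same edge multiplicities between every pair $(v_i,\hat v_j)$.
   Formalization: The distribution P on the nonnegative integers has rational probability masses. -}

module Defs where

open import Data.Nat as ℕ using (ℕ; zero; suc)
open import Data.Integer using (+_)
open import Data.Fin using (Fin; zero; suc)
open import Data.Fin.Properties using (all?; any?) renaming (_≟_ to _≟F_)
open import Data.Vec as Vec using (Vec; []; _++_; replicate; lookup)
open import Data.List as List using (List; []; _∷_; concatMap; map; length; filter)
open import Data.Product using (Σ; _,_; _×_; ∃)
open import Relation.Nullary using (Dec; yes; no; ¬_; _→-dec_; _×-dec_)
open import Relation.Binary.PropositionalEquality using (_≡_)
open import Data.Rational as ℚ using (ℚ; 0ℚ; 1ℚ; _/_; _÷_; _*_; _+_; _-_; _≤_; _<_; ≢-nonZero)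
open import Data.Rational.Properties using () renaming (_≟_ to _≟ℚ_)

Σℕ : ∀ {n} → (Fin n → ℕ) → ℕ
Σℕ {zero}  f = 0
Σℕ {suc n} f = f zero ℕ.+ Σℕ (λ i → f (suc i))

Πℚ : ∀ {n} → (Fin n → ℚ) → ℚ
Πℚ {zero}  f = 1ℚ
Πℚ {suc n} f = f zero * Πℚ (λ i → f (suc i))

countFin : ∀ {n} {P : Fin n → Set} → ((k : Fin n) → Dec (P k)) → ℕ
countFin {zero}  P? = 0
countFin {suc n} P? with P? zero
... | yes _ = suc (countFin (λ k → P? (suc k)))
... | no  _ = countFin (λ k → P? (suc k))

ℕ→ℚ : ℕ → ℚ
ℕ→ℚ k = + k / 1

-- ratio p/q, with the (irrelevant) convention p/0 = 0
ratio : ℚ → ℚ → ℚ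
ratio p q with q ≟ℚ 0ℚ
... | yes _  = 0ℚ
... | no q≢0 = _÷_ p q {{≢-nonZero q≢0}}

partialSum : (ℕ → ℚ) → ℕ → ℚ
partialSum P zero    = 0ℚ
partialSum P (suc N) = partialSum P N + P N

IsDistribution : (ℕ → ℚ) → Set
IsDistribution P =
  (∀ k → 0ℚ ≤ P k) ×
  (∀ N → partialSum P N ≤ 1ℚ) ×
  (∀ (ε : ℚ) → 0ℚ < ε → ∃ λ N → 1ℚ - ε < partialSum P N)

-- Bipartite multigraphs between users Fin n and ads Fin m,
-- given by edge multiplicities.

Multigraph : ℕ → ℕ → Set
Multigraph n m = Fin n → Fin m → ℕ

_≈G_ : ∀ {n m} → Multigraph n m → Multigraph n m → Set
G ≈G H = ∀ i j → G i j ≡ H i j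

_≈G?_ : ∀ {n m} (G H : Multigraph n m) → Dec (G ≈G H)
G ≈G? H = all? (λ i → all? (λ j → G i j ℕ.≟ H i j))

userDeg : ∀ {n m} → Multigraph n m → Fin n → ℕ
userDeg G i = Σℕ (λ j → G i j)

adDeg : ∀ {n m} → Multigraph n m → Fin m → ℕ
adDeg G j = Σℕ (λ i → G i j)

_≗?_ : ∀ {n} (f g : Fin n → ℕ) → Dec (∀ i → f i ≡ g i)
f ≗? g = all? (λ i → f i ℕ.≟ g i)

-- An outcome with user-degree vector d is ω : (i : Fin n) → Fin (d i) → Fin m,
-- the ordered list of ads sampled (with replacement) by each user.

allFuns : (k m : ℕ) → List (Fin k → Fin m)
allFuns zero    m = (λ ()) ∷ []
allFuns (suc k) m =
  concatMap (λ a → map (λ f → cons a f) (allFuns k m)) (List.allFin m)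
  where
  cons : Fin m → (Fin k → Fin m) → Fin (suc k) → Fin m
  cons a f zero    = a
  cons a f (suc x) = f x

Outcome : ∀ {n} → (d : Fin n → ℕ) → ℕ → Set
Outcome {n} d m = (i : Fin n) → Fin (d i) → Fin m

allOutcomes : ∀ {n} (d : Fin n → ℕ) (m : ℕ) → List (Outcome d m)
allOutcomes {zero}  d m = (λ ()) ∷ []
allOutcomes {suc n} d m =
  concatMap (λ f → map (λ r → consD f r) (allOutcomes (λ i → d (suc i)) m))
            (allFuns (d zero) m)
  where
  consD : (Fin (d zero) → Fin m) → Outcome (λ i → d (suc i)) m → Outcome d m
  consD f r zero    = f
  consD f r (suc i) = r i

graphL : ∀ {n m} {d : Fin n → ℕ} → Outcome d m → Multigraph n m
graphL {d = d} ω i j = countFin (λ k → ω i k ≟F j)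

weightL : ∀ {n} → (ℕ → ℚ) → (d : Fin n → ℕ) → ℕ → ℚ
weightL P d m = Πℚ (λ i → P (d i)) * ratio 1ℚ (ℕ→ℚ (m ℕ.^ Σℕ d))

PrL-G-and-deg : ∀ {n m} → (ℕ → ℚ) → Multigraph n m →
                (Fin n → ℕ) → (Fin m → ℕ) → ℚ
PrL-G-and-deg {n} {m} P G d d̂ =
  weightL P d m *
  ℕ→ℚ (length (filter (λ ω → (graphL ω ≈G? G) ×-dec (adDeg (graphL ω) ≗? d̂))
                      (allOutcomes d m)))

PrL-deg : ∀ {n m} → (ℕ → ℚ) → (Fin n → ℕ) → (Fin m → ℕ) → ℚ
PrL-deg {n} {m} P d d̂ =
  weightL P d m *
  ℕ→ℚ (length (filter (λ ω → adDeg (graphL ω) ≗? d̂) (allOutcomes d m)))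

PrL-cond : ∀ {n m} → (ℕ → ℚ) → Multigraph n m →
           (Fin n → ℕ) → (Fin m → ℕ) → ℚ
PrL-cond P G d d̂ = ratio (PrL-G-and-deg P G d d̂) (PrL-deg P d d̂)

-- Configuration model CM(d, d̂).
-- Configuration points of the users are Fin (Σ d); point p belongs to
-- vertex (owners d)[p]  (vertex i owns exactly d i points).

owners : ∀ {n} (d : Fin n → ℕ) → Vec (Fin n) (Σℕ d)
owners {zero}  d = []
owners {suc n} d = replicate (d zero) zero ++ Vec.map suc (owners (λ i → d (suc i)))

-- perfect matchings between user points and ad points = bijections
IsBijection : ∀ {a b} → (Fin a → Fin b) → Set
IsBijection f = (∀ x y → f x ≡ f y → x ≡ y) × (∀ y → ∃ λ x → f x ≡ y)

isBijection? : ∀ {a b} (f : Fin a → Fin b) → Dec (IsBijection f)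
isBijection? f =
  all? (λ x → all? (λ y → (f x ≟F f y) →-dec (x ≟F y)))
  ×-dec all? (λ y → any? (λ x → f x ≟F y))

matchings : ∀ {n m} (d : Fin n → ℕ) (d̂ : Fin m → ℕ) → List (Fin (Σℕ d) → Fin (Σℕ d̂))
matchings d d̂ = filter isBijection? (allFuns (Σℕ d) (Σℕ d̂))

graphCM : ∀ {n m} (d : Fin n → ℕ) (d̂ : Fin m → ℕ) →
          (Fin (Σℕ d) → Fin (Σℕ d̂)) → Multigraph n m
graphCM d d̂ σ i j =
  countFin (λ p → (lookup (owners d) p ≟F i) ×-dec (lookup (owners d̂) (σ p) ≟F j))

PrCM : ∀ {n m} (d : Fin n → ℕ) (d̂ : Fin m → ℕ) → Multigraph n m → ℚ
PrCM d d̂ G =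
  ratio (ℕ→ℚ (length (filter (λ σ → graphCM d d̂ σ ≈G? G) (matchings d d̂))))
        (ℕ→ℚ (length (matchings d d̂)))

{-# OPTIONS --safe #-}

-- An outcome of L(n,n,P) with user degrees d amounts to a map s : Fin (Σ d) → Fin n sending each
-- user configuration point to an ad, and all such maps have the same probability weightL P d n;
-- conditioned on the ad degrees d̂, the map s is therefore uniform among those whose fibres have
-- sizes d̂. A perfect matching σ of configuration points yields the map owner d̂ ∘ σ, which has the
-- same graph, and each map with fibre sizes d̂ arises from exactly ∏ⱼ d̂ⱼ! matchings (one bijection
-- between the fibres of s and of owner d̂ over every ad). So both sides equal the proportion of maps
-- s with fibre sizes d̂ whose graph is G.

module Submission where

open import Defs
open import Data.Nat using (ℕ)
open import Data.Fin using (Fin)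
open import Data.Rational using (ℚ; 0ℚ; _<_)
open import Relation.Binary.PropositionalEquality using (_≡_)

open import Data.Nat as ℕ using (zero; suc; _+_; _*_; _∸_; _^_; _!)
open import Data.Nat.Properties
  using (+-identityʳ; *-identityˡ; *-identityʳ; *-assoc; 1+n≢0; +-assoc; +-cancelˡ-≡; m+n∸m≡n;
         m^n≢0; m*n≢0; _!≢0; +-*-semiring; *-1-commutativeMonoid; *-commutativeSemigroup)
open import Data.Fin.Base using (zero; suc; punchIn; punchOut; _↑ˡ_; _↑ʳ_; splitAt)
open import Data.Fin.Properties using (_≟_; ¬Fin0; punchInᵢ≢i; punchIn-injective; punchIn-punchOut; suc-injective)
open import Data.Vec.Functional using (Vector; []; _∷_; _++_)
open import Data.Vec.Functional.Properties using (∷-cong; ++-cong; lookup-++ˡ; lookup-++ʳ)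
import Data.Vec.Base as Vec
import Data.Vec.Properties as Vec
open import Data.Sum.Base using (inj₁; inj₂)
open import Data.Product.Base using (_,_; proj₁; proj₂; ∃)
open import Data.List.Base using (allFin; filter)
open import Function.Base using (_∘_; id; const)
open import Function.Bundles using (_⇔_; mk⇔; Equivalence)
open import Relation.Binary.Core using (_Preserves_⟶_)
open import Relation.Binary.PropositionalEquality
  using (_≢_; refl; sym; trans; cong; cong₂; subst; _≗_; module ≡-Reasoning)
open import Relation.Nullary using (Dec; yes; no; ¬_; contradiction)
open import Relation.Nullary.Decidable using (_×-dec_)

open import Algebra.Properties.Semiring.Sum +-*-semiring
  using (sum; sum-syntax; sum-cong-≗; sum-remove; sum-replicate-zero; ∑-comm; *-distribˡ-sum; *-distribʳ-sum)
open import Algebra.Properties.CommutativeSemigroup *-commutativeSemigroup using (x∙yz≈y∙xz; xy∙z≈y∙zx)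
open import Algebra.Properties.CommutativeMonoid.Sum *-1-commutativeMonoid
  using () renaming (sum to product; sum-remove to product-remove; sum-cong-≗ to product-cong-≗;
                     sum-replicate-zero to product-replicate-one)

import Data.Integer.Base as ℤ
import Data.Integer.Properties as ℤ
import Data.Rational.Base as ℚ
open import Data.Rational.Base using (1ℚ)
import Data.Rational.Properties as ℚ
import Data.Rational.Unnormalised.Base as ℚᵘ
import Data.Rational.Unnormalised.Properties as ℚᵘ

private variable
  A B C : Set
  P Q : Set
  a b k m n : ℕ

𝟙 : Dec P → ℕ
𝟙 (yes _) = 1
𝟙 (no _)  = 0

𝟙-yes : (P? : Dec P) → P → 𝟙 P? ≡ 1
𝟙-yes (yes _) _  = refl
𝟙-yes (no ¬p) p = contradiction p ¬p

𝟙-no : (P? : Dec P) → ¬ P → 𝟙 P? ≡ 0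
𝟙-no (yes p) ¬p = contradiction p ¬p
𝟙-no (no _)  _  = refl

𝟙-cong : (P? : Dec P) (Q? : Dec Q) → P ⇔ Q → 𝟙 P? ≡ 𝟙 Q?
𝟙-cong P? (yes q) P⇔Q = 𝟙-yes P? (Equivalence.from P⇔Q q)
𝟙-cong P? (no ¬q) P⇔Q = 𝟙-no P? (¬q ∘ Equivalence.to P⇔Q)

𝟙-× : (P? : Dec P) (Q? : Dec Q) → 𝟙 (P? ×-dec Q?) ≡ 𝟙 P? * 𝟙 Q?
𝟙-× (yes _) (yes _) = refl
𝟙-× (yes _) (no _)  = refl
𝟙-× (no _)  _       = refl

𝟙-suc≟suc : (x y : Fin n) → 𝟙 (suc x ≟ suc y) ≡ 𝟙 (x ≟ y)
𝟙-suc≟suc x y = 𝟙-cong (suc x ≟ suc y) (x ≟ y) (mk⇔ suc-injective (cong suc))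

𝟙-≗?-congˡ : {f g : Fin n → ℕ} → f ≗ g → (h : Fin n → ℕ) → 𝟙 (f ≗? h) ≡ 𝟙 (g ≗? h)
𝟙-≗?-congˡ {f = f} {g} f≗g h = 𝟙-cong (f ≗? h) (g ≗? h)
  (mk⇔ (λ f≗h j → trans (sym (f≗g j)) (f≗h j)) (λ g≗h j → trans (f≗g j) (g≗h j)))

𝟙-≗?-congʳ : (f : Fin n → ℕ) {g h : Fin n → ℕ} → g ≗ h → 𝟙 (f ≗? g) ≡ 𝟙 (f ≗? h)
𝟙-≗?-congʳ f {g} {h} g≗h = 𝟙-cong (f ≗? g) (f ≗? h)
  (mk⇔ (λ f≗g j → trans (f≗g j) (g≗h j)) (λ f≗h j → trans (f≗h j) (sym (g≗h j))))

Σℕ≡sum : (f : Fin n → ℕ) → Σℕ f ≡ sum f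
Σℕ≡sum {zero}  f = refl
Σℕ≡sum {suc n} f = cong (f zero +_) (Σℕ≡sum (f ∘ suc))

countFin≡sum : {P : Fin n → Set} (P? : ∀ k → Dec (P k)) → countFin P? ≡ ∑[ k < n ] 𝟙 (P? k)
countFin≡sum {zero}  P? = refl
countFin≡sum {suc n} P? with P? zero
... | yes _ = cong suc (countFin≡sum (P? ∘ suc))
... | no _  = countFin≡sum (P? ∘ suc)

sum-zero : (f : Fin n → ℕ) → (∀ i → f i ≡ 0) → sum f ≡ 0
sum-zero {n} f f≗0 = trans (sum-cong-≗ f≗0) (sum-replicate-zero n)

sum-ones : ∀ n → ∑[ i < n ] 1 ≡ n
sum-ones zero    = refl
sum-ones (suc n) = cong suc (sum-ones n)

sum-↑ : (f : Fin (a + b) → ℕ) → sum f ≡ ∑[ i < a ] f (i ↑ˡ b) + ∑[ j < b ] f (a ↑ʳ j)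
sum-↑ {zero}  f = refl
sum-↑ {suc a} {b} f = trans (cong (f zero +_) (sum-↑ {a} {b} (f ∘ suc))) (sym (+-assoc (f zero) _ _))

sum-delta : (x : Fin n) (h : Fin n → ℕ) → ∑[ j < n ] (𝟙 (x ≟ j) * h j) ≡ h x
sum-delta {suc n} x h = begin
  ∑[ j < suc n ] (𝟙 (x ≟ j) * h j)
    ≡⟨ sum-remove {i = x} (λ j → 𝟙 (x ≟ j) * h j) ⟩
  𝟙 (x ≟ x) * h x + ∑[ j < n ] (𝟙 (x ≟ punchIn x j) * h (punchIn x j))
    ≡⟨ cong₂ _+_ (cong (_* h x) (𝟙-yes (x ≟ x) refl))
                 (sum-zero _ (λ j → cong (_* h (punchIn x j)) (𝟙-no (x ≟ punchIn x j) (punchInᵢ≢i x j ∘ sym)))) ⟩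
  h x + 0 + 0
    ≡⟨ trans (+-identityʳ _) (+-identityʳ (h x)) ⟩
  h x ∎
  where open ≡-Reasoning

countFin-cong : {P Q : Fin n → Set} (P? : ∀ k → Dec (P k)) (Q? : ∀ k → Dec (Q k)) →
                (∀ k → 𝟙 (P? k) ≡ 𝟙 (Q? k)) → countFin P? ≡ countFin Q?
countFin-cong P? Q? eq = trans (countFin≡sum P?) (trans (sum-cong-≗ eq) (sym (countFin≡sum Q?)))

-- A separate scope, since Data.List's [] and _∷_ clash with those of Data.Vec.Functional.
module _ where
  open import Data.List.Base using (List; []; _∷_; map; concatMap; length; tabulate)
  open import Data.List.Properties using (map-++; map-cong; map-∘)
  import Data.Nat.ListAction as List
  open import Data.Nat.ListAction.Properties using (sum-++)

  listSum : (A → ℕ) → List A → ℕ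
  listSum F xs = List.sum (map F xs)

  listSum-cong : {F G : A → ℕ} (xs : List A) → F ≗ G → listSum F xs ≡ listSum G xs
  listSum-cong xs F≗G = cong List.sum (map-cong F≗G xs)

  listSum-concatMap-map : (F : C → ℕ) (g : A → B → C) (xs : List A) (ys : List B) →
                          listSum F (concatMap (λ x → map (g x) ys) xs) ≡ listSum (λ x → listSum (F ∘ g x) ys) xs
  listSum-concatMap-map F g []       ys = refl
  listSum-concatMap-map F g (x ∷ xs) ys =
    trans (cong List.sum (map-++ F (map (g x) ys) _))
          (trans (sum-++ (map F (map (g x) ys)) _)
                 (cong₂ _+_ (cong List.sum (sym (map-∘ ys))) (listSum-concatMap-map F g xs ys)))

  listSum-tabulate : (F : A → ℕ) (g : Fin n → A) → listSum F (tabulate g) ≡ ∑[ i < n ] F (g i)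
  listSum-tabulate {n = zero}  F g = refl
  listSum-tabulate {n = suc n} F g = cong (F (g zero) +_) (listSum-tabulate F (g ∘ suc))

  listSum-filter : {P : A → Set} (F : A → ℕ) (P? : ∀ x → Dec (P x)) (xs : List A) →
                   listSum F (filter P? xs) ≡ listSum (λ x → 𝟙 (P? x) * F x) xs
  listSum-filter F P? []       = refl
  listSum-filter F P? (x ∷ xs) with P? x
  ... | yes _ = cong₂ _+_ (sym (+-identityʳ (F x))) (listSum-filter F P? xs)
  ... | no _  = listSum-filter F P? xs

  length≡listSum : (xs : List A) → length xs ≡ listSum (λ _ → 1) xs
  length≡listSum []       = refl
  length≡listSum (x ∷ xs) = cong suc (length≡listSum xs)

  length-filter : {P : A → Set} (P? : ∀ x → Dec (P x)) (xs : List A) →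
                  length (filter P? xs) ≡ listSum (𝟙 ∘ P?) xs
  length-filter P? xs = begin
    length (filter P? xs)                       ≡⟨ length≡listSum (filter P? xs) ⟩
    listSum (λ _ → 1) (filter P? xs)            ≡⟨ listSum-filter (λ _ → 1) P? xs ⟩
    listSum (λ x → 𝟙 (P? x) * 1) xs             ≡⟨ listSum-cong xs (λ x → *-identityʳ (𝟙 (P? x))) ⟩
    listSum (𝟙 ∘ P?) xs                         ∎
    where open ≡-Reasoning

∷-congʳ : (x : A) {f g : Vector A a} → f ≗ g → x ∷ f ≗ x ∷ g
∷-congʳ x = ∷-cong refl

∷-++ : (x : A) (f : Vector A a) (g : Vector A b) → x ∷ (f ++ g) ≗ (x ∷ f) ++ g
∷-++ x f g zero = refl
∷-++ {a = a} x f g (suc i) with splitAt a i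
... | inj₁ _ = refl
... | inj₂ _ = refl

sumFun : ∀ k {m} → ((Fin k → Fin m) → ℕ) → ℕ
sumFun zero    F = F []
sumFun (suc k) F = sum (λ x → sumFun k (λ f → F (x ∷ f)))

sumFun-cong : ∀ k {m} {F G : (Fin k → Fin m) → ℕ} → F ≗ G → sumFun k F ≡ sumFun k G
sumFun-cong zero    F≗G = F≗G []
sumFun-cong (suc k) F≗G = sum-cong-≗ (λ x → sumFun-cong k (λ f → F≗G (x ∷ f)))

sumFun-zero : ∀ k {m} (F : (Fin k → Fin m) → ℕ) → (∀ f → F f ≡ 0) → sumFun k F ≡ 0
sumFun-zero zero    F F≗0 = F≗0 []
sumFun-zero (suc k) F F≗0 = sum-zero _ (λ x → sumFun-zero k _ (λ f → F≗0 (x ∷ f)))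

sumFun-*ˡ : ∀ k {m} c (F : (Fin k → Fin m) → ℕ) → sumFun k (λ f → c * F f) ≡ c * sumFun k F
sumFun-*ˡ zero    c F = refl
sumFun-*ˡ (suc k) c F = trans (sum-cong-≗ (λ x → sumFun-*ˡ k c (λ f → F (x ∷ f))))
                              (sym (*-distribˡ-sum c (λ x → sumFun k (λ f → F (x ∷ f)))))

-- allFuns builds its functions with a cons local to Defs, equal to _∷_ only pointwise; hence the
-- congruence hypothesis, here and in listSum-allOutcomes.
listSum-allFuns : ∀ k {m} (F : (Fin k → Fin m) → ℕ) → F Preserves _≗_ ⟶ _≡_ →
                  listSum F (allFuns k m) ≡ sumFun k F
listSum-allFuns zero    F F-cong = trans (+-identityʳ _) (F-cong (λ ()))
listSum-allFuns (suc k) {m} F F-cong =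
  trans (listSum-concatMap-map F _ (allFin m) (allFuns k m))
        (trans (listSum-tabulate {n = m} _ id) (sum-cong-≗ λ x →
          trans (listSum-cong {G = λ f → F (x ∷ f)} (allFuns k m) λ f → F-cong λ { zero → refl ; (suc _) → refl })
                (listSum-allFuns k (λ f → F (x ∷ f)) (F-cong ∘ ∷-congʳ x))))

sumFun-++ : ∀ a b {m} (F : (Fin (a + b) → Fin m) → ℕ) → F Preserves _≗_ ⟶ _≡_ →
            sumFun (a + b) F ≡ sumFun a (λ f → sumFun b (λ g → F (f ++ g)))
sumFun-++ zero    b F F-cong = sumFun-cong b (λ g → F-cong (λ _ → refl))
sumFun-++ (suc a) b F F-cong = sum-cong-≗ λ x →
  trans (sumFun-++ a b (λ f → F (x ∷ f)) (F-cong ∘ ∷-congʳ x))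
        (sumFun-cong a (λ f → sumFun-cong b (λ g → F-cong (∷-++ x f g))))

sumFun-punchIn : ∀ a {m} (x : Fin (suc m)) (F : (Fin a → Fin (suc m)) → ℕ) → F Preserves _≗_ ⟶ _≡_ →
                 (∀ τ p → τ p ≡ x → F τ ≡ 0) → sumFun a F ≡ sumFun a (λ τ → F (punchIn x ∘ τ))
sumFun-punchIn zero    x F F-cong F-hit = F-cong (λ ())
sumFun-punchIn (suc a) x F F-cong F-hit = begin
  sum (λ y → sumFun a (λ τ → F (y ∷ τ)))
    ≡⟨ sum-remove {i = x} (λ y → sumFun a (λ τ → F (y ∷ τ))) ⟩
  sumFun a (λ τ → F (x ∷ τ)) + sum (λ y → sumFun a (λ τ → F (punchIn x y ∷ τ)))
    ≡⟨ cong₂ _+_ (sumFun-zero a _ (λ τ → F-hit (x ∷ τ) zero refl)) (sum-cong-≗ recurse) ⟩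
  sum (λ y → sumFun a (λ τ → F (punchIn x ∘ (y ∷ τ)))) ∎
  where
  open ≡-Reasoning
  recurse : ∀ y → sumFun a (λ τ → F (punchIn x y ∷ τ)) ≡ sumFun a (λ τ → F (punchIn x ∘ (y ∷ τ)))
  recurse y = trans
    (sumFun-punchIn a x (λ τ → F (punchIn x y ∷ τ)) (F-cong ∘ ∷-congʳ (punchIn x y)) (λ τ p → F-hit _ (suc p)))
    (sumFun-cong a (λ τ → F-cong λ { zero → refl ; (suc _) → refl }))

fibreSize : (Fin a → Fin n) → Fin n → ℕ
fibreSize s j = sum (λ p → 𝟙 (s p ≟ j))

fibreSize-remove : (s : Fin (suc a) → Fin n) (p : Fin (suc a)) (j : Fin n) →
                   fibreSize s j ≡ 𝟙 (s p ≟ j) + fibreSize (s ∘ punchIn p) j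
fibreSize-remove s p j = sum-remove {i = p} (λ q → 𝟙 (s q ≟ j))

fibreSize-self : (s : Fin a → Fin n) (p : Fin a) → fibreSize s (s p) ≢ 0
fibreSize-self {suc a} s p fibre≡0 = 1+n≢0 (begin
  1 + rest             ≡⟨ cong (_+ rest) (𝟙-yes (s p ≟ s p) refl) ⟨
  𝟙 (s p ≟ s p) + rest ≡⟨ fibreSize-remove s p (s p) ⟨
  fibreSize s (s p)    ≡⟨ fibre≡0 ⟩
  0                    ∎)
  where
  open ≡-Reasoning
  rest = fibreSize (s ∘ punchIn p) (s p)

decrementAt : (Fin n → ℕ) → Fin n → Fin n → ℕ
decrementAt c y j = c j ∸ 𝟙 (y ≟ j)

decrementAt-+ : (c : Fin n → ℕ) (y : Fin n) → c y ≡ suc k → ∀ j → 𝟙 (y ≟ j) + decrementAt c y j ≡ c j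
decrementAt-+ c y cy≡1+k j with y ≟ j
... | yes refl = trans (cong (λ z → suc (z ∸ 1)) cy≡1+k) (sym cy≡1+k)
... | no _     = refl

fibreSize-punchIn : (s : Fin (suc a) → Fin n) (p : Fin (suc a)) →
                    fibreSize (s ∘ punchIn p) ≗ decrementAt (fibreSize s) (s p)
fibreSize-punchIn s p j =
  sym (trans (cong (_∸ 𝟙 (s p ≟ j)) (fibreSize-remove s p j)) (m+n∸m≡n (𝟙 (s p ≟ j)) _))

sum-fibres : (o : Fin m → Fin n) (h : Fin n → ℕ) → ∑[ x < m ] h (o x) ≡ ∑[ y < n ] (fibreSize o y * h y)
sum-fibres {m} {n} o h = begin
  ∑[ x < m ] h (o x)                        ≡⟨ sum-cong-≗ (λ x → sym (sum-delta (o x) h)) ⟩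
  ∑[ x < m ] ∑[ y < n ] (𝟙 (o x ≟ y) * h y) ≡⟨ ∑-comm (λ x y → 𝟙 (o x ≟ y) * h y) ⟩
  ∑[ y < n ] ∑[ x < m ] (𝟙 (o x ≟ y) * h y) ≡⟨ sum-cong-≗ (λ y → sym (*-distribʳ-sum (h y) (λ x → 𝟙 (o x ≟ y)))) ⟩
  ∑[ y < n ] (fibreSize o y * h y)          ∎
  where open ≡-Reasoning

-- For c = fibreSize o this is the number of bijections σ with o ∘ σ ≗ s (sumFun-bijections).
liftCount : (Fin n → ℕ) → (Fin a → Fin n) → ℕ
liftCount c s = 𝟙 (fibreSize s ≗? c) * product (λ j → c j !)

liftCount-cong : {c c′ : Fin n → ℕ} → c ≗ c′ → (s : Fin a → Fin n) → liftCount c s ≡ liftCount c′ s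
liftCount-cong c≗c′ s = cong₂ _*_ (𝟙-≗?-congʳ (fibreSize s) c≗c′) (product-cong-≗ (cong _! ∘ c≗c′))

product!-decrementAt : (c : Fin n → ℕ) (y : Fin n) → c y ≡ suc k →
                       product (λ j → c j !) ≡ suc k * product (λ j → decrementAt c y j !)
product!-decrementAt {n = suc n} {k = k} c y cy≡1+k = begin
  product (λ j → c j !)
    ≡⟨ product-remove {i = y} (λ j → c j !) ⟩
  c y ! * product (λ j → c (punchIn y j) !)
    ≡⟨ cong₂ (λ z r → z ! * r) cy≡1+k (product-cong-≗ (λ j → cong _! (sym (decrementAt-punchIn j)))) ⟩
  suc k ! * product (λ j → decrementAt c y (punchIn y j) !)
    ≡⟨ *-assoc (suc k) (k !) _ ⟩
  suc k * (k ! * product (λ j → decrementAt c y (punchIn y j) !))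
    ≡⟨ cong (λ z → suc k * (z ! * _)) decrementAt-self ⟨
  suc k * (decrementAt c y y ! * product (λ j → decrementAt c y (punchIn y j) !))
    ≡⟨ cong (suc k *_) (product-remove {i = y} (λ j → decrementAt c y j !)) ⟨
  suc k * product (λ j → decrementAt c y j !) ∎
  where
  open ≡-Reasoning
  decrementAt-self : decrementAt c y y ≡ k
  decrementAt-self = cong₂ _∸_ cy≡1+k (𝟙-yes (y ≟ y) refl)
  decrementAt-punchIn : ∀ j → decrementAt c y (punchIn y j) ≡ c (punchIn y j)
  decrementAt-punchIn j = cong (c (punchIn y j) ∸_) (𝟙-no (y ≟ punchIn y j) (punchInᵢ≢i y j ∘ sym))

fibreSize-∷ : (c : Fin n → ℕ) (y : Fin n) (s : Fin a → Fin n) → c y ≡ suc k →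
              (fibreSize s ≗ decrementAt c y) ⇔ (fibreSize (y ∷ s) ≗ c)
fibreSize-∷ c y s cy≡1+k = mk⇔
  (λ eq j → trans (cong (𝟙 (y ≟ j) +_) (eq j)) (decrementAt-+ c y cy≡1+k j))
  (λ eq j → +-cancelˡ-≡ (𝟙 (y ≟ j)) _ _ (trans (eq j) (sym (decrementAt-+ c y cy≡1+k j))))

liftCount-∷ : (c : Fin n → ℕ) (y : Fin n) (s : Fin a → Fin n) →
              c y * liftCount (decrementAt c y) s ≡ liftCount c (y ∷ s)
liftCount-∷ c y s with c y in cy
... | zero  = sym (cong (_* product (λ j → c j !))
                    (𝟙-no (fibreSize (y ∷ s) ≗? c) (λ eq → fibreSize-self (y ∷ s) zero (trans (eq y) cy))))
... | suc k = begin
  suc k * (𝟙 fits * Π′)                         ≡⟨ x∙yz≈y∙xz (suc k) (𝟙 fits) Π′ ⟩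
  𝟙 fits * (suc k * Π′)                         ≡⟨ cong₂ _*_ (𝟙-cong fits (fibreSize (y ∷ s) ≗? c) (fibreSize-∷ c y s cy))
                                                             (sym (product!-decrementAt c y cy)) ⟩
  𝟙 (fibreSize (y ∷ s) ≗? c) * product (λ j → c j !) ∎
  where
  open ≡-Reasoning
  fits = fibreSize s ≗? decrementAt c y
  Π′ = product (λ j → decrementAt c y j !)

product!-nonZero : (c : Fin n → ℕ) → ℕ.NonZero (product (λ j → c j !))
product!-nonZero {zero}  c = _
product!-nonZero {suc n} c = m*n≢0 (c zero !) _ {{c zero !≢0}} {{product!-nonZero (c ∘ suc)}}

IsBijection-cong : {f g : Fin a → Fin b} → f ≗ g → IsBijection f → IsBijection g
IsBijection-cong f≗g (injective , surjective) =
  (λ x y gx≡gy → injective x y (trans (f≗g x) (trans gx≡gy (sym (f≗g y))))) ,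
  (λ y → proj₁ (surjective y) , trans (sym (f≗g _)) (proj₂ (surjective y)))

𝟙-isBijection-cong : {f g : Fin a → Fin b} → f ≗ g → 𝟙 (isBijection? f) ≡ 𝟙 (isBijection? g)
𝟙-isBijection-cong f≗g = 𝟙-cong (isBijection? _) (isBijection? _)
  (mk⇔ (IsBijection-cong f≗g) (IsBijection-cong (sym ∘ f≗g)))

¬IsBijection-∷ : (x : Fin b) (τ : Fin a → Fin b) (p : Fin a) → τ p ≡ x → ¬ IsBijection (x ∷ τ)
¬IsBijection-∷ x τ p τp≡x (injective , _) with injective zero (suc p) (sym τp≡x)
... | ()

IsBijection-∷-punchIn : (x : Fin (suc b)) (τ : Fin a → Fin b) →
                        IsBijection (x ∷ punchIn x ∘ τ) ⇔ IsBijection τ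
IsBijection-∷-punchIn x τ = mk⇔ to from
  where
  to : IsBijection (x ∷ punchIn x ∘ τ) → IsBijection τ
  to (injective , surjective) = injective′ , surjective′
    where
    injective′ : ∀ p q → τ p ≡ τ q → p ≡ q
    injective′ p q τp≡τq = suc-injective (injective (suc p) (suc q) (cong (punchIn x) τp≡τq))
    surjective′ : ∀ y → ∃ λ p → τ p ≡ y
    surjective′ y with surjective (punchIn x y)
    ... | zero  , x≡y′ = contradiction (sym x≡y′) (punchInᵢ≢i x y)
    ... | suc p , τp≡y′ = p , punchIn-injective x _ _ τp≡y′
  from : IsBijection τ → IsBijection (x ∷ punchIn x ∘ τ)
  from (injective , surjective) = injective′ , surjective′
    where
    injective′ : ∀ p q → (x ∷ punchIn x ∘ τ) p ≡ (x ∷ punchIn x ∘ τ) q → p ≡ q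
    injective′ zero    zero    _  = refl
    injective′ zero    (suc q) eq = contradiction (sym eq) (punchInᵢ≢i x (τ q))
    injective′ (suc p) zero    eq = contradiction eq (punchInᵢ≢i x (τ p))
    injective′ (suc p) (suc q) eq = cong suc (injective p q (punchIn-injective x _ _ eq))
    surjective′ : ∀ y → ∃ λ p → (x ∷ punchIn x ∘ τ) p ≡ y
    surjective′ y with x ≟ y
    ... | yes x≡y = zero , x≡y
    ... | no x≢y  = suc (proj₁ (surjective (punchOut x≢y))) ,
                    trans (cong (punchIn x) (proj₂ (surjective (punchOut x≢y)))) (punchIn-punchOut x≢y)

𝟙-isBijection-[] : (o : Fin m → Fin n) → 𝟙 (isBijection? {0} {m} []) ≡ liftCount (fibreSize o) []
𝟙-isBijection-[] {zero} {n} o = trans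
  (𝟙-yes (isBijection? {0} {0} []) ((λ ()) , (λ ())))
  (sym (cong₂ _*_ (𝟙-yes (fibreSize [] ≗? fibreSize o) (λ _ → refl)) (product-replicate-one n)))
𝟙-isBijection-[] {suc m} o = trans
  (𝟙-no (isBijection? {0} {suc m} []) (λ (_ , surjective) → ¬Fin0 (proj₁ (surjective zero))))
  (sym (cong (_* product (λ j → fibreSize o j !))
             (𝟙-no (fibreSize [] ≗? fibreSize o) (λ []≗o → fibreSize-self o zero (sym ([]≗o (o zero)))))))

-- A bijection with σ 0 = x is x ∷ punchIn x ∘ τ for a bijection τ; grouping the x by o x, each
-- value y occurs fibreSize o y times, which liftCount-∷ absorbs.
sumFun-bijections : ∀ a {m n} (o : Fin m → Fin n) (R : (Fin a → Fin n) → ℕ) → R Preserves _≗_ ⟶ _≡_ →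
                    sumFun a (λ σ → 𝟙 (isBijection? σ) * R (o ∘ σ)) ≡
                    sumFun a (λ s → liftCount (fibreSize o) s * R s)
sumFun-bijections zero    o R R-cong = cong₂ _*_ (𝟙-isBijection-[] o) (R-cong (λ ()))
sumFun-bijections (suc a) {m} {n} o R R-cong = begin
  ∑[ x < m ] sumFun a (λ τ → 𝟙 (isBijection? (x ∷ τ)) * R (o ∘ (x ∷ τ)))   ≡⟨ sum-cong-≗ (sum-bijections-∷ o) ⟩
  ∑[ x < m ] liftsWithHead (o x)                                         ≡⟨ sum-fibres o liftsWithHead ⟩
  ∑[ y < n ] (fibreSize o y * liftsWithHead y)                           ≡⟨ sum-cong-≗ absorb-fibreSize ⟩
  ∑[ y < n ] sumFun a (λ s → liftCount (fibreSize o) (y ∷ s) * R (y ∷ s)) ∎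
  where
  open ≡-Reasoning
  liftsWithHead : Fin n → ℕ
  liftsWithHead y = sumFun a (λ s → liftCount (decrementAt (fibreSize o) y) s * R (y ∷ s))

  absorb-fibreSize : ∀ y → fibreSize o y * liftsWithHead y ≡
                           sumFun a (λ s → liftCount (fibreSize o) (y ∷ s) * R (y ∷ s))
  absorb-fibreSize y = trans (sym (sumFun-*ˡ a (fibreSize o y) _)) (sumFun-cong a λ s →
    trans (sym (*-assoc (fibreSize o y) _ _)) (cong (_* R (y ∷ s)) (liftCount-∷ (fibreSize o) y s)))

  sum-bijections-∷ : ∀ {m} (o : Fin m → Fin n) (x : Fin m) →
    sumFun a (λ τ → 𝟙 (isBijection? (x ∷ τ)) * R (o ∘ (x ∷ τ))) ≡
    sumFun a (λ s → liftCount (decrementAt (fibreSize o) (o x)) s * R (o x ∷ s))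
  sum-bijections-∷ {suc m} o x = begin
    sumFun a (λ τ → 𝟙 (isBijection? (x ∷ τ)) * R (o ∘ (x ∷ τ)))
      ≡⟨ sumFun-punchIn a x _ F-cong F-hit ⟩
    sumFun a (λ τ → 𝟙 (isBijection? (x ∷ punchIn x ∘ τ)) * R (o ∘ (x ∷ punchIn x ∘ τ)))
      ≡⟨ sumFun-cong a (λ τ → cong₂ _*_ (𝟙-cong (isBijection? _) (isBijection? τ) (IsBijection-∷-punchIn x τ))
                                         (R-cong λ { zero → refl ; (suc _) → refl })) ⟩
    sumFun a (λ τ → 𝟙 (isBijection? τ) * R (o x ∷ (o ∘ punchIn x) ∘ τ))
      ≡⟨ sumFun-bijections a (o ∘ punchIn x) (λ s → R (o x ∷ s)) (R-cong ∘ ∷-congʳ (o x)) ⟩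
    sumFun a (λ s → liftCount (fibreSize (o ∘ punchIn x)) s * R (o x ∷ s))
      ≡⟨ sumFun-cong a (λ s → cong (_* R (o x ∷ s)) (liftCount-cong (fibreSize-punchIn o x) s)) ⟩
    sumFun a (λ s → liftCount (decrementAt (fibreSize o) (o x)) s * R (o x ∷ s)) ∎
    where
    F : (Fin a → Fin (suc m)) → ℕ
    F τ = 𝟙 (isBijection? (x ∷ τ)) * R (o ∘ (x ∷ τ))
    F-cong : F Preserves _≗_ ⟶ _≡_
    F-cong τ≗τ′ = cong₂ _*_ (𝟙-isBijection-cong (∷-congʳ x τ≗τ′)) (R-cong (cong o ∘ ∷-congʳ x τ≗τ′))
    F-hit : ∀ τ p → τ p ≡ x → F τ ≡ 0
    F-hit τ p τp≡x = cong (_* R (o ∘ (x ∷ τ))) (𝟙-no (isBijection? (x ∷ τ)) (¬IsBijection-∷ x τ p τp≡x))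

adDeg-cong : {G H : Multigraph n m} → G ≈G H → adDeg G ≗ adDeg H
adDeg-cong {G = G} {H} G≈H j =
  trans (Σℕ≡sum (λ i → G i j)) (trans (sum-cong-≗ (λ i → G≈H i j)) (sym (Σℕ≡sum (λ i → H i j))))

owner : (d : Fin n → ℕ) → Fin (Σℕ d) → Fin n
owner d = Vec.lookup (owners d)

configPoint : (d : Fin n → ℕ) (i : Fin n) → Fin (d i) → Fin (Σℕ d)
configPoint {suc n} d zero    k = k ↑ˡ Σℕ (d ∘ suc)
configPoint {suc n} d (suc i) k = d zero ↑ʳ configPoint (d ∘ suc) i k

owner-↑ˡ : (d : Fin (suc n) → ℕ) (k : Fin (d zero)) → owner d (k ↑ˡ Σℕ (d ∘ suc)) ≡ zero
owner-↑ˡ d k = trans (Vec.lookup-++ˡ (Vec.replicate (d zero) zero) _ k) (Vec.lookup-replicate k zero)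

owner-↑ʳ : (d : Fin (suc n) → ℕ) (q : Fin (Σℕ (d ∘ suc))) → owner d (d zero ↑ʳ q) ≡ suc (owner (d ∘ suc) q)
owner-↑ʳ d q = trans (Vec.lookup-++ʳ (Vec.replicate (d zero) zero) _ q) (Vec.lookup-map q suc (owners (d ∘ suc)))

sum-owner : (d : Fin n → ℕ) (i : Fin n) (h : Fin (Σℕ d) → ℕ) →
            ∑[ p < Σℕ d ] (𝟙 (owner d p ≟ i) * h p) ≡ ∑[ k < d i ] h (configPoint d i k)
sum-owner {suc n} d i h = trans (sum-↑ {d zero} {Σℕ (d ∘ suc)} _) (split i)
  where
  N′ = Σℕ (d ∘ suc)
  split : ∀ i → ∑[ k < d zero ] (𝟙 (owner d (k ↑ˡ N′) ≟ i) * h (k ↑ˡ N′)) +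
                ∑[ q < N′ ] (𝟙 (owner d (d zero ↑ʳ q) ≟ i) * h (d zero ↑ʳ q)) ≡
                ∑[ k < d i ] h (configPoint d i k)
  split zero = trans
    (cong₂ _+_ (sum-cong-≗ λ k → trans (cong (λ o → 𝟙 (o ≟ zero) * h (k ↑ˡ N′)) (owner-↑ˡ d k)) (+-identityʳ _))
               (sum-zero _ λ q → cong (λ o → 𝟙 (o ≟ zero) * h (d zero ↑ʳ q)) (owner-↑ʳ d q)))
    (+-identityʳ _)
  split (suc i) = cong₂ _+_
    (sum-zero _ λ k → cong (λ o → 𝟙 (o ≟ suc i) * h (k ↑ˡ N′)) (owner-↑ˡ d k))
    (trans (sum-cong-≗ λ q → trans (cong (λ o → 𝟙 (o ≟ suc i) * h (d zero ↑ʳ q)) (owner-↑ʳ d q))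
                                    (cong (_* h (d zero ↑ʳ q)) (𝟙-suc≟suc (owner (d ∘ suc) q) i)))
           (sum-owner (d ∘ suc) i (h ∘ (d zero ↑ʳ_))))

fibreSize-owner : (d : Fin n → ℕ) → fibreSize (owner d) ≗ d
fibreSize-owner d i = begin
  ∑[ p < Σℕ d ] 𝟙 (owner d p ≟ i)         ≡⟨ sum-cong-≗ (λ p → sym (*-identityʳ (𝟙 (owner d p ≟ i)))) ⟩
  ∑[ p < Σℕ d ] (𝟙 (owner d p ≟ i) * 1)   ≡⟨ sum-owner d i (λ _ → 1) ⟩
  ∑[ k < d i ] 1                          ≡⟨ sum-ones (d i) ⟩
  d i                                     ∎
  where open ≡-Reasoning

pointGraph : (Fin k → Fin n) → (Fin k → Fin m) → Multigraph n m
pointGraph u s i j = countFin (λ p → (u p ≟ i) ×-dec (s p ≟ j))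

pointGraph-sum : (u : Fin k → Fin n) (s : Fin k → Fin m) (i : Fin n) (j : Fin m) →
                 pointGraph u s i j ≡ ∑[ p < k ] (𝟙 (u p ≟ i) * 𝟙 (s p ≟ j))
pointGraph-sum u s i j = trans (countFin≡sum (λ p → (u p ≟ i) ×-dec (s p ≟ j))) (sum-cong-≗ (λ p → 𝟙-× (u p ≟ i) (s p ≟ j)))

pointGraph-cong : (u : Fin k → Fin n) {s s′ : Fin k → Fin m} → s ≗ s′ → pointGraph u s ≈G pointGraph u s′
pointGraph-cong u {s} {s′} s≗s′ i j =
  countFin-cong (λ p → (u p ≟ i) ×-dec (s p ≟ j)) (λ p → (u p ≟ i) ×-dec (s′ p ≟ j)) λ p → cong (λ y → 𝟙 ((u p ≟ i) ×-dec (y ≟ j))) (s≗s′ p)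

adDeg-pointGraph : (u : Fin k → Fin n) (s : Fin k → Fin m) → adDeg (pointGraph u s) ≗ fibreSize s
adDeg-pointGraph {k} {n} u s j = begin
  Σℕ (λ i → pointGraph u s i j)                          ≡⟨ Σℕ≡sum (λ i → pointGraph u s i j) ⟩
  ∑[ i < n ] pointGraph u s i j                          ≡⟨ sum-cong-≗ (λ i → pointGraph-sum u s i j) ⟩
  ∑[ i < n ] ∑[ p < k ] (𝟙 (u p ≟ i) * 𝟙 (s p ≟ j))      ≡⟨ ∑-comm (λ i p → 𝟙 (u p ≟ i) * 𝟙 (s p ≟ j)) ⟩
  ∑[ p < k ] ∑[ i < n ] (𝟙 (u p ≟ i) * 𝟙 (s p ≟ j))      ≡⟨ sum-cong-≗ (λ p → sum-delta (u p) (λ _ → 𝟙 (s p ≟ j))) ⟩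
  fibreSize s j                                          ∎
  where open ≡-Reasoning

unflatten : (d : Fin n → ℕ) → (Fin (Σℕ d) → Fin m) → Outcome d m
unflatten d s i = s ∘ configPoint d i

_≋_ : {d : Fin n → ℕ} → Outcome d m → Outcome d m → Set
ω ≋ ω′ = ∀ i → ω i ≗ ω′ i

graphL-cong : {d : Fin n → ℕ} {ω ω′ : Outcome d m} → ω ≋ ω′ → graphL ω ≈G graphL ω′
graphL-cong {ω = ω} {ω′} ω≋ω′ i j = countFin-cong (λ k → ω i k ≟ j) (λ k → ω′ i k ≟ j) λ k → cong (λ y → 𝟙 (y ≟ j)) (ω≋ω′ i k)

graphL-unflatten : (d : Fin n → ℕ) (s : Fin (Σℕ d) → Fin m) → graphL (unflatten d s) ≈G pointGraph (owner d) s
graphL-unflatten d s i j = begin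
  countFin (λ k → s (configPoint d i k) ≟ j)         ≡⟨ countFin≡sum (λ k → s (configPoint d i k) ≟ j) ⟩
  ∑[ k < d i ] 𝟙 (s (configPoint d i k) ≟ j)          ≡⟨ sum-owner d i (λ p → 𝟙 (s p ≟ j)) ⟨
  ∑[ p < Σℕ d ] (𝟙 (owner d p ≟ i) * 𝟙 (s p ≟ j))     ≡⟨ pointGraph-sum (owner d) s i j ⟨
  pointGraph (owner d) s i j                         ∎
  where open ≡-Reasoning

listSum-allOutcomes : (d : Fin n → ℕ) (F : Outcome d m → ℕ) → F Preserves _≋_ ⟶ _≡_ →
                      listSum F (allOutcomes d m) ≡ sumFun (Σℕ d) (F ∘ unflatten d)
listSum-allOutcomes {zero}      d F F-cong = trans (+-identityʳ _) (F-cong (λ ()))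
listSum-allOutcomes {suc n} {m} d F F-cong = begin
  listSum F (allOutcomes d m)
    ≡⟨ trans (listSum-concatMap-map F _ (allFuns (d zero) m) (allOutcomes (d ∘ suc) m))
             (listSum-cong {G = λ f → sumFun N′ (λ g → F (unflatten d (f ++ g)))} (allFuns (d zero) m) λ f →
                trans (listSum-allOutcomes (d ∘ suc) _ λ r≋r′ → F-cong λ { zero → λ _ → refl ; (suc i) → r≋r′ i })
                      (sumFun-cong N′ λ g → F-cong λ { zero k → sym (lookup-++ˡ f g k)
                                                     ; (suc i) k → sym (lookup-++ʳ f g (configPoint (d ∘ suc) i k)) })) ⟩
  listSum (λ f → sumFun N′ (λ g → F (unflatten d (f ++ g)))) (allFuns (d zero) m)
    ≡⟨ listSum-allFuns (d zero) _ (λ {f} {f′} f≗f′ → sumFun-cong N′ λ g → F-cong (unflatten-cong (++-cong f f′ f≗f′ (λ _ → refl)))) ⟩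
  sumFun (d zero) (λ f → sumFun N′ (λ g → F (unflatten d (f ++ g))))
    ≡⟨ sumFun-++ (d zero) N′ (F ∘ unflatten d) (F-cong ∘ unflatten-cong) ⟨
  sumFun (Σℕ d) (F ∘ unflatten d) ∎
  where
  open ≡-Reasoning
  N′ = Σℕ (d ∘ suc)
  unflatten-cong : {s s′ : Fin (Σℕ d) → Fin m} → s ≗ s′ → unflatten d s ≋ unflatten d s′
  unflatten-cong s≗s′ i = s≗s′ ∘ configPoint d i

conditionedCount : (d : Fin n → ℕ) (d̂ : Fin m → ℕ) → (Multigraph n m → ℕ) → ℕ
conditionedCount {m = m} d d̂ R = listSum (λ ω → R (graphL ω) * 𝟙 (adDeg (graphL ω) ≗? d̂)) (allOutcomes d m)

matchingCount : (d : Fin n → ℕ) (d̂ : Fin m → ℕ) → (Multigraph n m → ℕ) → ℕ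
matchingCount d d̂ R = listSum (R ∘ graphCM d d̂) (matchings d d̂)

conditionedCount-flat : (d : Fin n → ℕ) (d̂ : Fin m → ℕ) (R : Multigraph n m → ℕ) → R Preserves _≈G_ ⟶ _≡_ →
                        conditionedCount d d̂ R ≡
                        sumFun (Σℕ d) (λ s → R (pointGraph (owner d) s) * 𝟙 (fibreSize s ≗? d̂))
conditionedCount-flat d d̂ R R-cong = trans (listSum-allOutcomes d _ F-cong) (sumFun-cong (Σℕ d) λ s →
  cong₂ _*_ (R-cong (graphL-unflatten d s))
            (𝟙-≗?-congˡ (λ j → trans (adDeg-cong (graphL-unflatten d s) j) (adDeg-pointGraph (owner d) s j)) d̂))
  where
  F-cong : (λ ω → R (graphL ω) * 𝟙 (adDeg (graphL ω) ≗? d̂)) Preserves _≋_ ⟶ _≡_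
  F-cong ω≋ω′ = cong₂ _*_ (R-cong (graphL-cong ω≋ω′)) (𝟙-≗?-congˡ (adDeg-cong (graphL-cong ω≋ω′)) d̂)

matchingCount-flat : (d : Fin n → ℕ) (d̂ : Fin m → ℕ) (R : Multigraph n m → ℕ) → R Preserves _≈G_ ⟶ _≡_ →
                     matchingCount d d̂ R ≡ sumFun (Σℕ d) (λ s → liftCount d̂ s * R (pointGraph (owner d) s))
matchingCount-flat d d̂ R R-cong = begin
  listSum (R ∘ graphCM d d̂) (filter isBijection? (allFuns (Σℕ d) (Σℕ d̂)))
    ≡⟨ listSum-filter (R ∘ graphCM d d̂) isBijection? (allFuns (Σℕ d) (Σℕ d̂)) ⟩
  listSum (λ σ → 𝟙 (isBijection? σ) * R (graphCM d d̂ σ)) (allFuns (Σℕ d) (Σℕ d̂))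
    ≡⟨ listSum-allFuns (Σℕ d) _ (λ σ≗σ′ → cong₂ _*_ (𝟙-isBijection-cong σ≗σ′)
                                                     (R-cong (pointGraph-cong (owner d) (cong (owner d̂) ∘ σ≗σ′)))) ⟩
  sumFun (Σℕ d) (λ σ → 𝟙 (isBijection? σ) * R (pointGraph (owner d) (owner d̂ ∘ σ)))
    ≡⟨ sumFun-bijections (Σℕ d) (owner d̂) (R ∘ pointGraph (owner d)) (R-cong ∘ pointGraph-cong (owner d)) ⟩
  sumFun (Σℕ d) (λ s → liftCount (fibreSize (owner d̂)) s * R (pointGraph (owner d) s))
    ≡⟨ sumFun-cong (Σℕ d) (λ s → cong (_* R (pointGraph (owner d) s)) (liftCount-cong (fibreSize-owner d̂) s)) ⟩
  sumFun (Σℕ d) (λ s → liftCount d̂ s * R (pointGraph (owner d) s)) ∎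
  where open ≡-Reasoning

matchingCount≡conditionedCount : (d : Fin n → ℕ) (d̂ : Fin m → ℕ) (R : Multigraph n m → ℕ) → R Preserves _≈G_ ⟶ _≡_ →
                                 matchingCount d d̂ R ≡ product (λ j → d̂ j !) * conditionedCount d d̂ R
matchingCount≡conditionedCount d d̂ R R-cong = begin
  matchingCount d d̂ R
    ≡⟨ matchingCount-flat d d̂ R R-cong ⟩
  sumFun (Σℕ d) (λ s → 𝟙 (fibreSize s ≗? d̂) * K * R (pointGraph (owner d) s))
    ≡⟨ sumFun-cong (Σℕ d) (λ s → xy∙z≈y∙zx (𝟙 (fibreSize s ≗? d̂)) K (R (pointGraph (owner d) s))) ⟩
  sumFun (Σℕ d) (λ s → K * (R (pointGraph (owner d) s) * 𝟙 (fibreSize s ≗? d̂)))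
    ≡⟨ sumFun-*ˡ (Σℕ d) K _ ⟩
  K * sumFun (Σℕ d) (λ s → R (pointGraph (owner d) s) * 𝟙 (fibreSize s ≗? d̂))
    ≡⟨ cong (K *_) (conditionedCount-flat d d̂ R R-cong) ⟨
  K * conditionedCount d d̂ R ∎
  where
  open ≡-Reasoning
  K = product (λ j → d̂ j !)

ℕ→ℚ-* : ∀ a b → ℕ→ℚ (a * b) ≡ ℕ→ℚ a ℚ.* ℕ→ℚ b
ℕ→ℚ-* a b = ℚ.toℚᵘ-injective (ℚᵘ.≃-trans (ℚ.toℚᵘ-fromℚᵘ (ℚᵘ.mkℚᵘ (ℤ.+ (a * b)) 0))
  (ℚᵘ.≃-sym (ℚᵘ.≃-trans (ℚ.toℚᵘ-homo-* (ℕ→ℚ a) (ℕ→ℚ b))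
    (ℚᵘ.≃-trans (ℚᵘ.*-cong (ℚ.toℚᵘ-fromℚᵘ (ℚᵘ.mkℚᵘ (ℤ.+ a) 0)) (ℚ.toℚᵘ-fromℚᵘ (ℚᵘ.mkℚᵘ (ℤ.+ b) 0)))
                (ℚᵘ.*≡* (cong (ℤ._* ℤ.+ 1) (sym (ℤ.pos-* a b))))))))

ℕ→ℚ-pos : ∀ k → .{{ℕ.NonZero k}} → 0ℚ < ℕ→ℚ k
ℕ→ℚ-pos (suc k) = ℚ.positive⁻¹ (ℕ→ℚ (suc k)) {{ℚ.normalize-pos (suc k) 1}}

ratio≡÷ : ∀ p q .{{_ : ℚ.NonZero q}} → ratio p q ≡ p ℚ.÷ q
ratio≡÷ p q with q ℚ.≟ 0ℚ
... | yes refl = contradiction refl (ℕ.≢-nonZero⁻¹ 0)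
... | no _     = refl

ratio-*-cancelˡ : ∀ x p q .{{_ : ℚ.NonZero x}} → ratio (x ℚ.* p) (x ℚ.* q) ≡ ratio p q
ratio-*-cancelˡ x p q with q ℚ.≟ 0ℚ
... | yes refl = cong (ratio (x ℚ.* p)) (ℚ.*-zeroʳ x)
... | no q≢0   = trans (ratio≡÷ (x ℚ.* p) (x ℚ.* q)) cancel
  where
  instance _ = ℚ.≢-nonZero q≢0
  xq≢0 : x ℚ.* q ≢ 0ℚ
  xq≢0 xq≡0 = q≢0 (begin
    q                        ≡⟨ ℚ.*-identityˡ q ⟨
    1ℚ ℚ.* q                 ≡⟨ cong (ℚ._* q) (ℚ.*-inverseˡ x) ⟨
    (ℚ.1/ x ℚ.* x) ℚ.* q     ≡⟨ ℚ.*-assoc (ℚ.1/ x) x q ⟩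
    ℚ.1/ x ℚ.* (x ℚ.* q)     ≡⟨ cong (ℚ.1/ x ℚ.*_) xq≡0 ⟩
    ℚ.1/ x ℚ.* 0ℚ            ≡⟨ ℚ.*-zeroʳ (ℚ.1/ x) ⟩
    0ℚ                       ∎)
    where open ≡-Reasoning
  instance _ = ℚ.≢-nonZero xq≢0
  cancel : (x ℚ.* p) ℚ.* ℚ.1/ (x ℚ.* q) ≡ p ℚ.* ℚ.1/ q
  cancel = begin
    (x ℚ.* p) ℚ.* ℚ.1/ (x ℚ.* q)
      ≡⟨ ℚ.*-identityʳ _ ⟨
    ((x ℚ.* p) ℚ.* ℚ.1/ (x ℚ.* q)) ℚ.* 1ℚ
      ≡⟨ cong (((x ℚ.* p) ℚ.* ℚ.1/ (x ℚ.* q)) ℚ.*_) (ℚ.*-inverseʳ q) ⟨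
    ((x ℚ.* p) ℚ.* ℚ.1/ (x ℚ.* q)) ℚ.* (q ℚ.* ℚ.1/ q)
      ≡⟨ solve 5 (λ x p u q v → ((x :* p) :* u) :* (q :* v) := (p :* v) :* ((x :* q) :* u))
               refl x p (ℚ.1/ (x ℚ.* q)) q (ℚ.1/ q) ⟩
    (p ℚ.* ℚ.1/ q) ℚ.* ((x ℚ.* q) ℚ.* ℚ.1/ (x ℚ.* q))
      ≡⟨ cong ((p ℚ.* ℚ.1/ q) ℚ.*_) (ℚ.*-inverseʳ (x ℚ.* q)) ⟩
    (p ℚ.* ℚ.1/ q) ℚ.* 1ℚ
      ≡⟨ ℚ.*-identityʳ _ ⟩
    p ℚ.* ℚ.1/ q ∎
    where
    open ≡-Reasoning
    open import Data.Rational.Solver using (module +-*-Solver)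
    open +-*-Solver using (solve; _:=_; _:*_)

*-pos : ∀ {p q} → 0ℚ < p → 0ℚ < q → 0ℚ < p ℚ.* q
*-pos {p} {q} 0<p 0<q = ℚ.positive⁻¹ (p ℚ.* q) {{ℚ.pos*pos⇒pos p {{ℚ.positive 0<p}} q {{ℚ.positive 0<q}}}}

Πℚ-pos : (f : Fin n → ℚ) → (∀ i → 0ℚ < f i) → 0ℚ < Πℚ f
Πℚ-pos {zero}  f 0<f = ℚ.positive⁻¹ 1ℚ
Πℚ-pos {suc n} f 0<f = *-pos (0<f zero) (Πℚ-pos (f ∘ suc) (0<f ∘ suc))

ratio-1-pos : ∀ {q} → 0ℚ < q → 0ℚ < ratio 1ℚ q
ratio-1-pos {q} 0<q = subst (0ℚ <_) (sym (ratio≡÷ 1ℚ q))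
  (*-pos (ℚ.positive⁻¹ 1ℚ) (ℚ.positive⁻¹ (ℚ.1/ q) {{ℚ.1/pos⇒pos q}}))
  where
  instance
    _ = ℚ.positive 0<q
    _ = ℚ.pos⇒nonZero q

weightL-pos : (P : ℕ → ℚ) (d : Fin n → ℕ) → (∀ i → 0ℚ < P (d i)) → 0ℚ < weightL P d n
weightL-pos {n} P d 0<P = *-pos (Πℚ-pos (P ∘ d) 0<P) (ratio-1-pos (ℕ→ℚ-pos (n ^ Σℕ d) {{n^Σd≢0 n d}}))
  where
  n^Σd≢0 : ∀ n (d : Fin n → ℕ) → ℕ.NonZero (n ^ Σℕ d)
  n^Σd≢0 zero    d = _
  n^Σd≢0 (suc n) d = m^n≢0 (suc n) (Σℕ d)

ratio-ℕ→ℚ-*-cancelˡ : ∀ k a b → .{{ℕ.NonZero k}} → ratio (ℕ→ℚ (k * a)) (ℕ→ℚ (k * b)) ≡ ratio (ℕ→ℚ a) (ℕ→ℚ b)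
ratio-ℕ→ℚ-*-cancelˡ k a b = trans (cong₂ ratio (ℕ→ℚ-* k a) (ℕ→ℚ-* k b))
                                   (ratio-*-cancelˡ (ℕ→ℚ k) _ _ {{ℚ.>-nonZero (ℕ→ℚ-pos k)}})

𝟙-≈G?-cong : (G : Multigraph n m) → (λ H → 𝟙 (H ≈G? G)) Preserves _≈G_ ⟶ _≡_
𝟙-≈G?-cong G {H} {H′} H≈H′ = 𝟙-cong (H ≈G? G) (H′ ≈G? G)
  (mk⇔ (λ H≈G i j → trans (sym (H≈H′ i j)) (H≈G i j)) (λ H′≈G i j → trans (H≈H′ i j) (H′≈G i j)))

PrL-cond≡ratio : (P : ℕ → ℚ) (G : Multigraph n m) (d : Fin n → ℕ) (d̂ : Fin m → ℕ) →
                 PrL-cond P G d d̂ ≡ ratio (weightL P d m ℚ.* ℕ→ℚ (conditionedCount d d̂ (λ H → 𝟙 (H ≈G? G))))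
                                          (weightL P d m ℚ.* ℕ→ℚ (conditionedCount d d̂ (const 1)))
PrL-cond≡ratio {m = m} P G d d̂ = cong₂ (λ a b → ratio (weightL P d m ℚ.* ℕ→ℚ a) (weightL P d m ℚ.* ℕ→ℚ b))
  (trans (length-filter _ (allOutcomes d m))
         (listSum-cong (allOutcomes d m) λ ω → 𝟙-× (graphL ω ≈G? G) (adDeg (graphL ω) ≗? d̂)))
  (trans (length-filter _ (allOutcomes d m))
         (listSum-cong (allOutcomes d m) λ ω → sym (*-identityˡ _)))

PrCM≡ratio : (d : Fin n → ℕ) (d̂ : Fin m → ℕ) (G : Multigraph n m) →
             PrCM d d̂ G ≡ ratio (ℕ→ℚ (matchingCount d d̂ (λ H → 𝟙 (H ≈G? G))))
                                (ℕ→ℚ (matchingCount d d̂ (const 1)))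
PrCM≡ratio d d̂ G = cong₂ (λ a b → ratio (ℕ→ℚ a) (ℕ→ℚ b))
  (length-filter _ (matchings d d̂)) (length≡listSum (matchings d d̂))

lemma16 : (n : ℕ) (d d̂ : Fin n → ℕ) (P : ℕ → ℚ) →
          IsDistribution P →
          Σℕ d ≡ Σℕ d̂ →
          (∀ i → 0ℚ < P (d i)) →
          (G : Multigraph n n) →
          PrL-cond P G d d̂ ≡ PrCM d d̂ G
lemma16 n d d̂ P _ _ 0<P G = begin
  PrL-cond P G d d̂
    ≡⟨ PrL-cond≡ratio P G d d̂ ⟩
  ratio (w ℚ.* ℕ→ℚ (count 𝟙≈G)) (w ℚ.* ℕ→ℚ (count (const 1)))
    ≡⟨ ratio-*-cancelˡ w _ _ {{ℚ.>-nonZero (weightL-pos P d 0<P)}} ⟩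
  ratio (ℕ→ℚ (count 𝟙≈G)) (ℕ→ℚ (count (const 1)))
    ≡⟨ ratio-ℕ→ℚ-*-cancelˡ K _ _ {{product!-nonZero d̂}} ⟨
  ratio (ℕ→ℚ (K * count 𝟙≈G)) (ℕ→ℚ (K * count (const 1)))
    ≡⟨ cong₂ (λ a b → ratio (ℕ→ℚ a) (ℕ→ℚ b))
             (matchingCount≡conditionedCount d d̂ 𝟙≈G (𝟙-≈G?-cong G))
             (matchingCount≡conditionedCount d d̂ (const 1) (λ _ → refl)) ⟨
  ratio (ℕ→ℚ (matchingCount d d̂ 𝟙≈G)) (ℕ→ℚ (matchingCount d d̂ (const 1)))
    ≡⟨ PrCM≡ratio d d̂ G ⟨
  PrCM d d̂ G ∎
  where
  open ≡-Reasoning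
  w = weightL P d n
  K = product (λ j → d̂ j !)
  count = conditionedCount d d̂
  𝟙≈G : Multigraph n n → ℕ
  𝟙≈G H = 𝟙 (H ≈G? G)
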